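{- Let $n$ be a positive integer and let $s(n,3)$ denote the maximum cardinality of a Sidon-type set of strength $3$ in $\mathbb{Z}_n$. Then: (i) $s(n,3) \geq \lfloor n/4 \rfloor$ if $n$ is even; (ii) $s(n,3) \geq \lfloor (n+1)/6 \rfloor$ if $n$ is odd and has no divisors congruent to $5 \pmod 6$; (iii) $s(n,3) \geq \frac{(p+1)n}{6p}$ if $n$ is odd and $p$ is its smallest divisor which is congruent to $5 \pmod 6$.
   Context: For positive integers $n$ and $t$, a set $S$ of residues modulo $n$ (identified with integers in $[1,n]$) is a Sidon-type set of strength $t$ in $\mathbb{Z}_n$ if there is no non-trivial sum $\varepsilon_1 x_1 + \cdots + \varepsilon_t x_t \equiv 0 \pmod n$ with $\varepsilon_i \in \{0,1,-1\}$ and $x_1,\dots,x_t \in S$ (not necessarily distinct). Such a sum is called non-trivial if at least one $\varepsilon_i$ is nonzero and no element of $S$ appears in it both with coefficient $+1$ and with coefficient $-1$. $s(n,t)$ is the maximum cardinality of a Sidon-type set of strength $t$ in $\mathbb{Z}_n$. -}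

module Defs where

open import Data.Nat using (ℕ; zero; suc)
open import Data.Fin using (Fin; toℕ; zero; suc)
open import Data.Fin.Subset using (Subset; _∈_; ∣_∣)
open import Data.Integer using (ℤ; +_; -_; _+_; _*_)
open import Data.Integer.Divisibility using (_∣_)
open import Data.Product using (Σ; ∃; _×_; _,_)
open import Relation.Nullary using (¬_)
open import Relation.Binary.PropositionalEquality using (_≡_; _≢_)

data Sign : Set where
  zer pos neg : Sign

signℤ : Sign → ℤ
signℤ zer = + 0
signℤ pos = + 1
signℤ neg = - (+ 1)

sumFin : (t : ℕ) → (Fin t → ℤ) → ℤ
sumFin zero    f = + 0
sumFin (suc t) f = f zero + sumFin t (λ i → f (suc i))

signedSum : {n t : ℕ} → (Fin t → Fin n) → (Fin t → Sign) → ℤ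
signedSum {n} {t} x ε = sumFin t (λ i → signℤ (ε i) * + toℕ (x i))

NonTrivial : {n t : ℕ} → (Fin t → Fin n) → (Fin t → Sign) → Set
NonTrivial {n} {t} x ε =
  (∃ λ (i : Fin t) → ε i ≢ zer) ×
  ¬ (Σ (Fin t) λ i → Σ (Fin t) λ j → (ε i ≡ pos) × (ε j ≡ neg) × (x i ≡ x j))

IsSidonType : (n t : ℕ) → Subset n → Set
IsSidonType n t S =
  (x : Fin t → Fin n) → (ε : Fin t → Sign) →
  (∀ i → x i ∈ S) → NonTrivial x ε → ¬ ((+ n) ∣ signedSum x ε)

IsMaxSidon : (n t m : ℕ) → Set
IsMaxSidon n t m =
  (Σ (Subset n) λ S → IsSidonType n t S × ∣ S ∣ ≡ m) ×
  (∀ (S : Subset n) → IsSidonType n t S → ∣ S ∣ Data.Nat.≤ m)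

-- Up to sign, a non-trivial signed sum of at most three elements of a set
-- S ⊆ [0, n) is one of a, a + b, a + b + c, a + b − c, or a − b with a ≠ b;
-- the last is never divisible by n, so S is Sidon of strength 3 as soon as the
-- other four forms avoid multiples of n.  For even n, take the odd numbers
-- below n/2: one or two of them sum to a number in (0, n), while a + b + c and
-- a + b − c are odd.  For q ∣ n with 3(2k + 1) < q, take the x whose residue
-- mod q lies in [k + 1, 2k + 1]: each of the four forms then has a residue in
-- (0, q).  This set has (n/q)(k + 1) elements; q = n gives (ii) and q = p = 6k + 5
-- gives (iii).
module Submission where

open import Defs
open import Data.Fin using (Fin; toℕ)
open import Data.Fin.Patterns using (0F; 1F; 2F)
open import Data.Fin.Properties using (toℕ<n; toℕ-injective)
open import Data.Fin.Subset using (Subset; _∈_; ∣_∣)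
open import Data.Integer as ℤ using (ℤ; +_; -_)
import Data.Integer.Properties as ℤₚ
open import Data.Integer.Divisibility using () renaming (_∣_ to _∣ℤ_)
import Data.Integer.Divisibility.Signed as Signed
open import Data.Integer.Tactic.RingSolver using (solve)
open import Data.List using (_∷_; [])
open import Data.Nat using (ℕ; zero; suc; _+_; _*_; _∸_; _/_; _%_; _≤_; _<_; _≤?_; _<?_;
  NonZero; >-nonZero; z≤n; s≤s; s≤s⁻¹; z<s)
open import Data.Nat.Divisibility using (_∣_; _∤_; _∣?_; ∣-refl; ∣-trans; >⇒∤)
open import Data.Nat.DivMod using (m≡m%n+[m/n]*n; %-remove-+ˡ; m<n⇒m%n≡m; m/n*n≤m; m/n*n≡m; n/n≡1)
open import Data.Nat.Properties
import Data.Nat.Tactic.RingSolver as ℕRing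
open import Data.Product using (Σ; ∃; _×_; _,_)
open import Data.Vec as Vec using (Vec; lookup; tabulate)
open import Data.Vec.Properties using (lookup∘tabulate; lookup-replicate; []=⇒lookup)
open import Function using (_∘_; _$_)
open import Level using (0ℓ)
open import Relation.Binary.Definitions using (tri<; tri≈; tri>)
open import Relation.Binary.PropositionalEquality using (_≡_; _≢_; refl; sym; trans; cong; subst; module ≡-Reasoning)
open import Relation.Nullary using (¬_; yes; no; does; contradiction)
open import Relation.Nullary.Decidable using (_×-dec_; map′; from-no)
open import Relation.Unary using (Pred; Decidable)

private
  variable
    a b r s : ℤ
    m n q : ℕ
    P Q : Pred ℕ 0ℓ

0<m<n⇒n∤m : 0 < m → m < n → n ∤ m
0<m<n⇒n∤m 0<m = >⇒∤ {{>-nonZero 0<m}}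

infix 4 _≡_mod_
record _≡_mod_ (a r q : ℤ) : Set where
  constructor ≡mod
  field
    quotient : ℤ
    equation : a ≡ q ℤ.* quotient ℤ.+ r

≡mod-plus : ∀ {q} → a ≡ r mod q → b ≡ s mod q → a ℤ.+ b ≡ r ℤ.+ s mod q
≡mod-plus {r = r} {s = s} {q} (≡mod t refl) (≡mod u refl) =
  ≡mod (t ℤ.+ u) (solve (q ∷ t ∷ r ∷ u ∷ s ∷ []))

≡mod-minus : ∀ {q} → a ≡ r mod q → b ≡ s mod q → a ℤ.- b ≡ r ℤ.- s mod q
≡mod-minus {r = r} {s = s} {q} (≡mod t refl) (≡mod u refl) =
  ≡mod (t ℤ.- u) (solve (q ∷ t ∷ r ∷ u ∷ s ∷ []))

+m≡+[m%q]-mod : ∀ m q .{{_ : NonZero q}} → + m ≡ + (m % q) mod + q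
+m≡+[m%q]-mod m q = ≡mod (+ (m / q)) $ begin
  + m                              ≡⟨ cong +_ (m≡m%n+[m/n]*n m q) ⟩
  + (m % q + m / q * q)            ≡⟨ ℤₚ.pos-+ (m % q) (m / q * q) ⟩
  + (m % q) ℤ.+ + (m / q * q)      ≡⟨ ℤₚ.+-comm (+ (m % q)) (+ (m / q * q)) ⟩
  + (m / q * q) ℤ.+ + (m % q)      ≡⟨ cong (ℤ._+ + (m % q)) [m/q]*q≡q*[m/q] ⟩
  + q ℤ.* + (m / q) ℤ.+ + (m % q)  ∎
  where
  open ≡-Reasoning
  [m/q]*q≡q*[m/q] : + (m / q * q) ≡ + q ℤ.* + (m / q)
  [m/q]*q≡q*[m/q] = trans (ℤₚ.pos-* (m / q) q) (ℤₚ.*-comm (+ (m / q)) (+ q))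

≡mod-∤ : a ≡ + m mod + q → q ∤ m → ¬ + q ∣ℤ a
≡mod-∤ {q = q} (≡mod t refl) q∤m q∣a = q∤m $ Signed.∣⇒∣ᵤ $
  Signed.∣m+n∣m⇒∣n (Signed.∣ᵤ⇒∣ q∣a) (Signed.∣m⇒∣m*n t (Signed.∣-refl {+ q}))

∣+m-+n∣≡n∸m : ∀ {m n} → m ≤ n → ℤ.∣ + m ℤ.- + n ∣ ≡ n ∸ m
∣+m-+n∣≡n∸m {m} {n} m≤n = trans (cong ℤ.∣_∣ (ℤₚ.[+m]-[+n]≡m⊖n m n)) (ℤₚ.∣⊖∣-≤ m≤n)

+m-+n≡+[m∸n] : ∀ {m n} → n ≤ m → + m ℤ.- + n ≡ + (m ∸ n)
+m-+n≡+[m∸n] {m} {n} n≤m = trans (ℤₚ.[+m]-[+n]≡m⊖n m n) (ℤₚ.⊖-≥ n≤m)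

distinct-∤ : ∀ {m n q} → m < q → n < q → m ≢ n → ¬ + q ∣ℤ + m ℤ.- + n
distinct-∤ {m} {n} {q} m<q n<q m≢n q∣m-n with <-cmp m n
... | tri< m<n _ _ = 0<m<n⇒n∤m (m<n⇒0<n∸m m<n) (≤-<-trans (m∸n≤m n m) n<q)
  (subst (q ∣_) (∣+m-+n∣≡n∸m (<⇒≤ m<n)) q∣m-n)
... | tri≈ _ m≡n _ = m≢n m≡n
... | tri> _ _ n<m = 0<m<n⇒n∤m (m<n⇒0<n∸m n<m) (≤-<-trans (m∸n≤m m n) m<q)
  (subst (q ∣_) (trans (ℤₚ.∣i-j∣≡∣j-i∣ (+ m) (+ n)) (∣+m-+n∣≡n∸m (<⇒≤ n<m))) q∣m-n)

subsetOf : Decidable P → (n : ℕ) → Subset n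
subsetOf P? n = tabulate (λ i → does (P? (toℕ i)))

∈-subsetOf⁻ : (P? : Decidable P) {i : Fin n} → i ∈ subsetOf P? n → P (toℕ i)
∈-subsetOf⁻ P? {i} i∈S with P? (toℕ i) | trans (sym (lookup∘tabulate _ i)) ([]=⇒lookup i∈S)
... | yes p | _ = p
... | no _  | ()

∣subsetOf-+∣ : (P? : Decidable P) (m n : ℕ) →
  ∣ subsetOf P? (m + n) ∣ ≡ ∣ subsetOf P? m ∣ + ∣ subsetOf (λ x → P? (m + x)) n ∣
∣subsetOf-+∣ P? zero    n = refl
∣subsetOf-+∣ P? (suc m) n with P? 0
... | yes _ = cong suc (∣subsetOf-+∣ (λ x → P? (suc x)) m n)
... | no _  = ∣subsetOf-+∣ (λ x → P? (suc x)) m n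

∣subsetOf∣-mono-≤ : (P? : Decidable P) → m ≤ n → ∣ subsetOf P? m ∣ ≤ ∣ subsetOf P? n ∣
∣subsetOf∣-mono-≤ {m = m} {n} P? m≤n = begin
  ∣ subsetOf P? m ∣                                          ≤⟨ m≤m+n _ _ ⟩
  ∣ subsetOf P? m ∣ + ∣ subsetOf (λ x → P? (m + x)) (n ∸ m) ∣ ≡⟨ ∣subsetOf-+∣ P? m (n ∸ m) ⟨
  ∣ subsetOf P? (m + (n ∸ m)) ∣                              ≡⟨ cong (∣_∣ ∘ subsetOf P?) (m+[n∸m]≡n m≤n) ⟩
  ∣ subsetOf P? n ∣                                          ∎
  where open ≤-Reasoning

∣subsetOf∣-mono-⊆ : (P? : Decidable P) (Q? : Decidable Q) →
  (∀ {x} → x < n → P x → Q x) → ∣ subsetOf P? n ∣ ≤ ∣ subsetOf Q? n ∣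
∣subsetOf∣-mono-⊆ {n = zero}  P? Q? P⊆Q = z≤n
∣subsetOf∣-mono-⊆ {n = suc n} P? Q? P⊆Q with P? 0 | Q? 0
  | ∣subsetOf∣-mono-⊆ (λ x → P? (suc x)) (λ x → Q? (suc x)) (P⊆Q ∘ s≤s)
... | yes _ | yes _ | rest = s≤s rest
... | yes p | no ¬q | _    = contradiction (P⊆Q z<s p) ¬q
... | no _  | yes _ | rest = m≤n⇒m≤1+n rest
... | no _  | no _  | rest = rest

∣subsetOf∣-full : (P? : Decidable P) → (∀ {x} → x < n → P x) → ∣ subsetOf P? n ∣ ≡ n
∣subsetOf∣-full {n = zero}  P? all = refl
∣subsetOf∣-full {n = suc n} P? all with P? 0
... | yes _ = cong suc (∣subsetOf∣-full (λ x → P? (suc x)) (all ∘ s≤s))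
... | no ¬p = contradiction (all z<s) ¬p

∣subsetOf∣-periodic : (P? : Decidable P) → (∀ {x} → P x → P (q + x)) →
  ∀ m → m * ∣ subsetOf P? q ∣ ≤ ∣ subsetOf P? (m * q) ∣
∣subsetOf∣-periodic P? periodic zero    = z≤n
∣subsetOf∣-periodic {q = q} P? periodic (suc m) = begin
  ∣ subsetOf P? q ∣ + m * ∣ subsetOf P? q ∣                   ≤⟨ +-monoʳ-≤ ∣ subsetOf P? q ∣ IH ⟩
  ∣ subsetOf P? q ∣ + ∣ subsetOf P? (m * q) ∣                 ≤⟨ +-monoʳ-≤ ∣ subsetOf P? q ∣ shifted ⟩
  ∣ subsetOf P? q ∣ + ∣ subsetOf (λ x → P? (q + x)) (m * q) ∣ ≡⟨ ∣subsetOf-+∣ P? q (m * q) ⟨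
  ∣ subsetOf P? (q + m * q) ∣                                 ∎
  where
  open ≤-Reasoning
  IH = ∣subsetOf∣-periodic P? periodic m
  shifted = ∣subsetOf∣-mono-⊆ {n = m * q} P? (λ x → P? (q + x)) (λ _ → periodic)

record InWindow (q lo l : ℕ) .{{_ : NonZero q}} (x : ℕ) : Set where
  constructor window
  field
    lo≤x%q   : lo ≤ x % q
    x%q<lo+l : x % q < lo + l

inWindow? : ∀ q lo l .{{_ : NonZero q}} → Decidable (InWindow q lo l)
inWindow? q lo l x = map′ (λ (p , p′) → window p p′) (λ (window p p′) → p , p′)
  (lo ≤? x % q ×-dec x % q <? lo + l)

window-≡ : ∀ {q lo l x r} .{{_ : NonZero q}} → x % q ≡ r → lo ≤ r → r < lo + l → InWindow q lo l x
window-≡ refl = window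

∣subsetOf-window∣ : ∀ q lo l .{{_ : NonZero q}} → lo + l ≤ q →
  ∀ m → m * l ≤ ∣ subsetOf (inWindow? q lo l) (m * q) ∣
∣subsetOf-window∣ q lo l fits m = ≤-trans (*-monoʳ-≤ m block) (∣subsetOf∣-periodic W? shift m)
  where
  W? = inWindow? q lo l

  shift : ∀ {x} → InWindow q lo l x → InWindow q lo l (q + x)
  shift {x} (window lo≤ <lo+l) = window-≡ (%-remove-+ˡ x (∣-refl {q})) lo≤ <lo+l

  lo+x∈W : ∀ {x} → x < l → InWindow q lo l (lo + x)
  lo+x∈W {x} x<l = window-≡ (m<n⇒m%n≡m (<-≤-trans lo+x<lo+l fits)) (m≤m+n lo x) lo+x<lo+l
    where lo+x<lo+l = +-monoʳ-< lo x<l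

  block : l ≤ ∣ subsetOf W? q ∣
  block = begin
    l                                                       ≡⟨ ∣subsetOf∣-full (λ x → W? (lo + x)) lo+x∈W ⟨
    ∣ subsetOf (λ x → W? (lo + x)) l ∣                      ≤⟨ m≤n+m _ _ ⟩
    ∣ subsetOf W? lo ∣ + ∣ subsetOf (λ x → W? (lo + x)) l ∣ ≡⟨ ∣subsetOf-+∣ W? lo l ⟨
    ∣ subsetOf W? (lo + l) ∣                                ≤⟨ ∣subsetOf∣-mono-≤ W? fits ⟩
    ∣ subsetOf W? q ∣                                       ∎
    where open ≤-Reasoning

record Strength3Criterion (n : ℕ) (P : Pred ℕ 0ℓ) : Set where
  field
    single : ∀ {a} → P a → ¬ + n ∣ℤ + a
    pair   : ∀ {a b} → P a → P b → ¬ + n ∣ℤ + a ℤ.+ + b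
    triple : ∀ {a b c} → P a → P b → P c → ¬ + n ∣ℤ + a ℤ.+ + b ℤ.+ + c
    mixed  : ∀ {a b c} → P a → P b → P c → ¬ + n ∣ℤ + a ℤ.+ + b ℤ.- + c

module _ {n : ℕ} {P : Pred ℕ 0ℓ} (criterion : Strength3Criterion n P) where
  open Strength3Criterion criterion

  private
    -- A record rather than a bare negation, so that unifying `Avoids b` with
    -- `Avoids e` determines b; the ring solver needs both sides of its equation.
    record Avoids (a : ℤ) : Set where
      constructor avoids
      field ∤a : ¬ + n ∣ℤ a

    Value : ℤ → Set
    Value a = ∃ λ m → P m × m < n × + m ≡ a

    ≡-avoids : Avoids b → a ≡ b → Avoids a
    ≡-avoids ∤b refl = ∤b

    ≡--avoids : Avoids b → a ≡ - b → Avoids a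
    ≡--avoids {b = b} (avoids ∤b) refl = avoids (∤b ∘ subst (n ∣_) (ℤₚ.∣-i∣≡∣i∣ b))

    single′ : Value a → Avoids a
    single′ (_ , pa , _ , refl) = avoids (single pa)

    pair′ : Value a → Value b → Avoids (a ℤ.+ b)
    pair′ (_ , pa , _ , refl) (_ , pb , _ , refl) = avoids (pair pa pb)

    triple′ : ∀ {c} → Value a → Value b → Value c → Avoids (a ℤ.+ b ℤ.+ c)
    triple′ (_ , pa , _ , refl) (_ , pb , _ , refl) (_ , pc , _ , refl) = avoids (triple pa pb pc)

    mixed′ : ∀ {c} → Value a → Value b → Value c → Avoids (a ℤ.+ b ℤ.- c)
    mixed′ (_ , pa , _ , refl) (_ , pb , _ , refl) (_ , pc , _ , refl) = avoids (mixed pa pb pc)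

    distinct′ : Value a → Value b → a ≢ b → Avoids (a ℤ.- b)
    distinct′ (_ , _ , a<n , refl) (_ , _ , b<n , refl) a≢b =
      avoids (distinct-∤ a<n b<n (a≢b ∘ cong (+_)))

    [_,_,_] : ∀ {X : Set} → X → X → X → Vec X 3
    [ x , y , z ] = x Vec.∷ y Vec.∷ z Vec.∷ Vec.[]

    -- The sum is signedSum with sumFin 3 unfolded, spelled out for the ring solver.
    avoids₃ : ∀ s t u A B C → Value A → Value B → Value C →
      (∃ λ i → lookup [ s , t , u ] i ≢ zer) →
      (∀ i j → lookup [ s , t , u ] i ≡ pos → lookup [ s , t , u ] j ≡ neg →
               lookup [ A , B , C ] i ≢ lookup [ A , B , C ] j) →
      Avoids (signℤ s ℤ.* A ℤ.+ (signℤ t ℤ.* B ℤ.+ (signℤ u ℤ.* C ℤ.+ + 0)))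
    avoids₃ pos pos pos A B C a b c _ _     = ≡-avoids  (triple′ a b c) (solve (A ∷ B ∷ C ∷ []))
    avoids₃ pos pos neg A B C a b c _ _     = ≡-avoids  (mixed′ a b c) (solve (A ∷ B ∷ C ∷ []))
    avoids₃ pos pos zer A B C a b c _ _     = ≡-avoids  (pair′ a b) (solve (A ∷ B ∷ C ∷ []))
    avoids₃ pos neg pos A B C a b c _ _     = ≡-avoids  (mixed′ a c b) (solve (A ∷ B ∷ C ∷ []))
    avoids₃ pos neg neg A B C a b c _ _     = ≡--avoids (mixed′ b c a) (solve (A ∷ B ∷ C ∷ []))
    avoids₃ pos neg zer A B C a b c _ apart = ≡-avoids  (distinct′ a b (apart 0F 1F refl refl)) (solve (A ∷ B ∷ C ∷ []))
    avoids₃ pos zer pos A B C a b c _ _     = ≡-avoids  (pair′ a c) (solve (A ∷ B ∷ C ∷ []))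
    avoids₃ pos zer neg A B C a b c _ apart = ≡-avoids  (distinct′ a c (apart 0F 2F refl refl)) (solve (A ∷ B ∷ C ∷ []))
    avoids₃ pos zer zer A B C a b c _ _     = ≡-avoids  (single′ a) (solve (A ∷ B ∷ C ∷ []))
    avoids₃ neg pos pos A B C a b c _ _     = ≡-avoids  (mixed′ b c a) (solve (A ∷ B ∷ C ∷ []))
    avoids₃ neg pos neg A B C a b c _ _     = ≡--avoids (mixed′ a c b) (solve (A ∷ B ∷ C ∷ []))
    avoids₃ neg pos zer A B C a b c _ apart = ≡-avoids  (distinct′ b a (apart 1F 0F refl refl)) (solve (A ∷ B ∷ C ∷ []))
    avoids₃ neg neg pos A B C a b c _ _     = ≡--avoids (mixed′ a b c) (solve (A ∷ B ∷ C ∷ []))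
    avoids₃ neg neg neg A B C a b c _ _     = ≡--avoids (triple′ a b c) (solve (A ∷ B ∷ C ∷ []))
    avoids₃ neg neg zer A B C a b c _ _     = ≡--avoids (pair′ a b) (solve (A ∷ B ∷ C ∷ []))
    avoids₃ neg zer pos A B C a b c _ apart = ≡-avoids  (distinct′ c a (apart 2F 0F refl refl)) (solve (A ∷ B ∷ C ∷ []))
    avoids₃ neg zer neg A B C a b c _ _     = ≡--avoids (pair′ a c) (solve (A ∷ B ∷ C ∷ []))
    avoids₃ neg zer zer A B C a b c _ _     = ≡--avoids (single′ a) (solve (A ∷ B ∷ C ∷ []))
    avoids₃ zer pos pos A B C a b c _ _     = ≡-avoids  (pair′ b c) (solve (A ∷ B ∷ C ∷ []))
    avoids₃ zer pos neg A B C a b c _ apart = ≡-avoids  (distinct′ b c (apart 1F 2F refl refl)) (solve (A ∷ B ∷ C ∷ []))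
    avoids₃ zer pos zer A B C a b c _ _     = ≡-avoids  (single′ b) (solve (A ∷ B ∷ C ∷ []))
    avoids₃ zer neg pos A B C a b c _ apart = ≡-avoids  (distinct′ c b (apart 2F 1F refl refl)) (solve (A ∷ B ∷ C ∷ []))
    avoids₃ zer neg neg A B C a b c _ _     = ≡--avoids (pair′ b c) (solve (A ∷ B ∷ C ∷ []))
    avoids₃ zer neg zer A B C a b c _ _     = ≡--avoids (single′ b) (solve (A ∷ B ∷ C ∷ []))
    avoids₃ zer zer pos A B C a b c _ _     = ≡-avoids  (single′ c) (solve (A ∷ B ∷ C ∷ []))
    avoids₃ zer zer neg A B C a b c _ _     = ≡--avoids (single′ c) (solve (A ∷ B ∷ C ∷ []))
    avoids₃ zer zer zer A B C a b c (i , εi≢zer) _ = contradiction (lookup-replicate i zer) εi≢zer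

  strength3Criterion⇒sidon : (P? : Decidable P) → IsSidonType n 3 (subsetOf P? n)
  strength3Criterion⇒sidon P? x ε x∈S (nonzero , noClash) = Avoids.∤a $
    avoids₃ (ε 0F) (ε 1F) (ε 2F) (v 0F) (v 1F) (v 2F) (value 0F) (value 1F) (value 2F)
      (nonzero′ nonzero) apart
    where
    v : Fin 3 → ℤ
    v i = + toℕ (x i)

    value : ∀ i → Value (v i)
    value i = toℕ (x i) , ∈-subsetOf⁻ P? (x∈S i) , toℕ<n (x i) , refl

    nonzero′ : (∃ λ i → ε i ≢ zer) → ∃ λ i → lookup (tabulate ε) i ≢ zer
    nonzero′ (i , εi≢zer) = i , εi≢zer ∘ trans (sym (lookup∘tabulate ε i))

    apart : ∀ i j → lookup (tabulate ε) i ≡ pos → lookup (tabulate ε) j ≡ neg →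
            lookup (tabulate v) i ≢ lookup (tabulate v) j
    apart i j εi≡pos εj≡neg vi≡vj = noClash
      ( i , j
      , trans (sym (lookup∘tabulate ε i)) εi≡pos
      , trans (sym (lookup∘tabulate ε j)) εj≡neg
      , toℕ-injective (ℤₚ.+-injective
          (trans (sym (lookup∘tabulate v i)) (trans vi≡vj (lookup∘tabulate v j)))))

Sidon₃≥ : ℕ → ℕ → Set
Sidon₃≥ n k = Σ (Subset n) λ S → IsSidonType n 3 S × k ≤ ∣ S ∣

module _ {n h : ℕ} (2∣n : 2 ∣ n) (h*4≤n : h * 4 ≤ n) where

  private
    OddBelow : Pred ℕ 0ℓ
    OddBelow x = x < h * 2 × InWindow 2 1 1 x

    oddBelow? : Decidable OddBelow
    oddBelow? x = x <? h * 2 ×-dec inWindow? 2 1 1 x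

    h*2≤n : h * 2 ≤ n
    h*2≤n = ≤-trans (*-monoʳ-≤ h (s≤s (s≤s z≤n))) h*4≤n

    positive : ∀ {a} → InWindow 2 1 1 a → 0 < a
    positive {suc a} _ = z<s

    +a≡1 : ∀ {a} → InWindow 2 1 1 a → + a ≡ + 1 mod + 2
    +a≡1 {a} (window 1≤a%2 a%2<2) =
      subst (λ r → + a ≡ + r mod + 2) (≤-antisym (s≤s⁻¹ a%2<2) 1≤a%2) (+m≡+[m%q]-mod a 2)

    odd-∤ : ∀ {r} → a ≡ + r mod + 2 → 2 ∤ r → ¬ + n ∣ℤ a
    odd-∤ a≡r 2∤r = ≡mod-∤ a≡r 2∤r ∘ ∣-trans 2∣n

    criterion : Strength3Criterion n OddBelow
    criterion = record { single = single ; pair = pair ; triple = triple ; mixed = mixed }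
      where
      single : ∀ {a} → OddBelow a → ¬ + n ∣ℤ + a
      single (a<2h , a∈W) = 0<m<n⇒n∤m (positive a∈W) (<-≤-trans a<2h h*2≤n)

      pair : ∀ {a b} → OddBelow a → OddBelow b → ¬ + n ∣ℤ + a ℤ.+ + b
      pair {a} {b} (a<2h , a∈W) (b<2h , _) =
        0<m<n⇒n∤m (≤-trans (positive a∈W) (m≤m+n a b)) $ begin-strict
          a + b          <⟨ +-mono-<-≤ a<2h (<⇒≤ b<2h) ⟩
          h * 2 + h * 2  ≡⟨ *-distribˡ-+ h 2 2 ⟨
          h * 4          ≤⟨ h*4≤n ⟩
          n              ∎
        where open ≤-Reasoning

      triple : ∀ {a b c} → OddBelow a → OddBelow b → OddBelow c → ¬ + n ∣ℤ + a ℤ.+ + b ℤ.+ + c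
      triple (_ , a∈W) (_ , b∈W) (_ , c∈W) =
        odd-∤ (≡mod-plus (≡mod-plus (+a≡1 a∈W) (+a≡1 b∈W)) (+a≡1 c∈W)) (from-no (2 ∣? 3))

      mixed : ∀ {a b c} → OddBelow a → OddBelow b → OddBelow c → ¬ + n ∣ℤ + a ℤ.+ + b ℤ.- + c
      mixed (_ , a∈W) (_ , b∈W) (_ , c∈W) =
        odd-∤ (≡mod-minus (≡mod-plus (+a≡1 a∈W) (+a≡1 b∈W)) (+a≡1 c∈W)) (from-no (2 ∣? 1))

    size : h ≤ ∣ subsetOf oddBelow? n ∣
    size = begin
      h                                       ≡⟨ *-identityʳ h ⟨
      h * 1                                   ≤⟨ ∣subsetOf-window∣ 2 1 1 ≤-refl h ⟩
      ∣ subsetOf (inWindow? 2 1 1) (h * 2) ∣  ≤⟨ ∣subsetOf∣-mono-⊆ (inWindow? 2 1 1) oddBelow? _,_ ⟩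
      ∣ subsetOf oddBelow? (h * 2) ∣          ≤⟨ ∣subsetOf∣-mono-≤ oddBelow? h*2≤n ⟩
      ∣ subsetOf oddBelow? n ∣                ∎
      where open ≤-Reasoning

  sidon-odds : Sidon₃≥ n h
  sidon-odds = subsetOf oddBelow? n , strength3Criterion⇒sidon criterion oddBelow? , size

module _ {n q : ℕ} (k : ℕ) .{{_ : NonZero q}} (q∣n : q ∣ n) (3[2k+1]<q : 3 * (2 * k + 1) < q) where

  private
    Middle : Pred ℕ 0ℓ
    Middle = InWindow q (suc k) (suc k)

    middle? : Decidable Middle
    middle? = inWindow? q (suc k) (suc k)

    res : ∀ a → + a ≡ + (a % q) mod + q
    res a = +m≡+[m%q]-mod a q

    3max<q : (k + suc k) + (k + suc k) + (k + suc k) < q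
    3max<q = begin-strict
      (k + suc k) + (k + suc k) + (k + suc k)  ≡⟨ ℕRing.solve (k ∷ []) ⟩
      3 * (2 * k + 1)                          <⟨ 3[2k+1]<q ⟩
      q                                        ∎
      where open ≤-Reasoning

    positive : ∀ {a} → Middle a → 0 < a % q
    positive (window 1+k≤a%q _) = <-≤-trans z<s 1+k≤a%q

    sum₃<q : ∀ {a b c} → Middle a → Middle b → Middle c → a % q + b % q + c % q < q
    sum₃<q (window _ a%q<) (window _ b%q<) (window _ c%q<) =
      ≤-<-trans (+-mono-≤ (+-mono-≤ (s≤s⁻¹ a%q<) (s≤s⁻¹ b%q<)) (s≤s⁻¹ c%q<)) 3max<q

    residue-∤ : ∀ {r} → a ≡ + r mod + q → 0 < r → r < q → ¬ + n ∣ℤ a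
    residue-∤ a≡r 0<r r<q = ≡mod-∤ a≡r (0<m<n⇒n∤m 0<r r<q) ∘ ∣-trans q∣n

    criterion : Strength3Criterion n Middle
    criterion = record { single = single ; pair = pair ; triple = triple ; mixed = mixed }
      where
      single : ∀ {a} → Middle a → ¬ + n ∣ℤ + a
      single {a} a∈M = residue-∤ (res a) (positive a∈M)
        (≤-<-trans (≤-trans (m≤m+n _ _) (m≤m+n _ _)) (sum₃<q a∈M a∈M a∈M))

      pair : ∀ {a b} → Middle a → Middle b → ¬ + n ∣ℤ + a ℤ.+ + b
      pair {a} {b} a∈M b∈M = residue-∤ (≡mod-plus (res a) (res b))
        (≤-trans (positive a∈M) (m≤m+n _ _)) (≤-<-trans (m≤m+n _ _) (sum₃<q a∈M b∈M a∈M))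

      triple : ∀ {a b c} → Middle a → Middle b → Middle c → ¬ + n ∣ℤ + a ℤ.+ + b ℤ.+ + c
      triple {a} {b} {c} a∈M b∈M c∈M = residue-∤ (≡mod-plus (≡mod-plus (res a) (res b)) (res c))
        (≤-trans (≤-trans (positive a∈M) (m≤m+n _ _)) (m≤m+n _ _)) (sum₃<q a∈M b∈M c∈M)

      mixed : ∀ {a b c} → Middle a → Middle b → Middle c → ¬ + n ∣ℤ + a ℤ.+ + b ℤ.- + c
      mixed {a} {b} {c} a∈M b∈M c∈M = residue-∤
        (subst (λ r → + a ℤ.+ + b ℤ.- + c ≡ r mod + q) (+m-+n≡+[m∸n] (<⇒≤ c%q<a%q+b%q))
          (≡mod-minus (≡mod-plus (res a) (res b)) (res c)))
        (m<n⇒0<n∸m c%q<a%q+b%q)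
        (≤-<-trans (≤-trans (m∸n≤m (a % q + b % q) (c % q)) (m≤m+n _ _)) (sum₃<q a∈M b∈M c∈M))
        where
        c%q<a%q+b%q : c % q < a % q + b % q
        c%q<a%q+b%q = <-≤-trans (InWindow.x%q<lo+l c∈M)
          (+-mono-≤ (InWindow.lo≤x%q a∈M) (InWindow.lo≤x%q b∈M))

    middle-fits : suc k + suc k ≤ q
    middle-fits = ≤-<-trans (≤-trans (m≤m+n _ _) (m≤m+n _ _)) 3max<q

    size : n / q * suc k ≤ ∣ subsetOf middle? n ∣
    size = subst (λ m → n / q * suc k ≤ ∣ subsetOf middle? m ∣) (m/n*n≡m q∣n)
      (∣subsetOf-window∣ q (suc k) (suc k) middle-fits (n / q))

  sidon-middle : Sidon₃≥ n (n / q * suc k)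
  sidon-middle = subsetOf middle? n , strength3Criterion⇒sidon criterion middle? , size

3[2k+1]<5+k*6 : ∀ k → 3 * (2 * k + 1) < 5 + k * 6
3[2k+1]<5+k*6 k = begin-strict
  3 * (2 * k + 1)      <⟨ m<m+n (3 * (2 * k + 1)) {2} z<s ⟩
  3 * (2 * k + 1) + 2  ≡⟨ ℕRing.solve (k ∷ []) ⟩
  5 + k * 6            ∎
  where open ≤-Reasoning

sidon-[n+1]/6 : ∀ k .{{_ : NonZero n}} → suc k * 6 ≤ n + 1 → Sidon₃≥ n (suc k)
sidon-[n+1]/6 {n} k [1+k]*6≤n+1 = subst (Sidon₃≥ n) n/n*[1+k]≡1+k
  (sidon-middle k ∣-refl (<-≤-trans (3[2k+1]<5+k*6 k) 5+k*6≤n))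
  where
  n/n*[1+k]≡1+k = trans (cong (_* suc k) (n/n≡1 n)) (*-identityˡ (suc k))
  5+k*6≤n = s≤s⁻¹ (subst (suc k * 6 ≤_) (+-comm n 1) [1+k]*6≤n+1)

sidon-6k+5 : ∀ p k → p ≡ 5 + k * 6 → p ∣ n →
  Σ (Subset n) λ S → IsSidonType n 3 S × (p + 1) * n ≤ 6 * p * ∣ S ∣
sidon-6k+5 {n} _ k refl p∣n with sidon-middle k p∣n (3[2k+1]<5+k*6 k)
... | S , sidon , size = S , sidon , (begin
  (p + 1) * n              ≡⟨ cong ((p + 1) *_) (m/n*n≡m p∣n) ⟨
  (p + 1) * (n / p * p)    ≡⟨ [p+1][d*p]≡6p[d*[1+k]] k (n / p) ⟩
  6 * p * (n / p * suc k)  ≤⟨ *-monoʳ-≤ (6 * p) size ⟩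
  6 * p * ∣ S ∣            ∎)
  where
  open ≤-Reasoning
  p : ℕ
  p = 5 + k * 6
  [p+1][d*p]≡6p[d*[1+k]] : ∀ k d → (5 + k * 6 + 1) * (d * (5 + k * 6)) ≡ 6 * (5 + k * 6) * (d * suc k)
  [p+1][d*p]≡6p[d*[1+k]] = ℕRing.solve-∀

theorem4p1 : (n : ℕ) → .{{_ : NonZero n}} → (s : ℕ) → IsMaxSidon n 3 s →
    ((2 ∣ n) → n / 4 ≤ s) ×
    ((n % 2 ≡ 1) → (∀ d → d ∣ n → ¬ (d % 6 ≡ 5)) → (n + 1) / 6 ≤ s) ×
    ((p : ℕ) → n % 2 ≡ 1 → p ∣ n → p % 6 ≡ 5 →
      (∀ d → d ∣ n → d % 6 ≡ 5 → p ≤ d) →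
      (p + 1) * n ≤ 6 * p * s)
theorem4p1 n s (_ , maximal) = even , (λ _ _ → [n+1]/6≤s) , five-mod-six
  where
  lower : ∀ {k} → Sidon₃≥ n k → k ≤ s
  lower (S , sidon , k≤∣S∣) = ≤-trans k≤∣S∣ (maximal S sidon)

  even : 2 ∣ n → n / 4 ≤ s
  even 2∣n = lower (sidon-odds 2∣n (m/n*n≤m n 4))

  [n+1]/6≤s : (n + 1) / 6 ≤ s
  [n+1]/6≤s with (n + 1) / 6 in eq
  ... | zero  = z≤n
  ... | suc k = lower (sidon-[n+1]/6 k (subst (λ j → j * 6 ≤ n + 1) eq (m/n*n≤m (n + 1) 6)))

  five-mod-six : (p : ℕ) → n % 2 ≡ 1 → p ∣ n → p % 6 ≡ 5 →
    (∀ d → d ∣ n → d % 6 ≡ 5 → p ≤ d) → (p + 1) * n ≤ 6 * p * s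
  five-mod-six p _ p∣n p%6≡5 _ with sidon-6k+5 p (p / 6) p≡5+[p/6]*6 p∣n
    where p≡5+[p/6]*6 = trans (m≡m%n+[m/n]*n p 6) (cong (_+ p / 6 * 6) p%6≡5)
  ... | S , sidon , bound = ≤-trans bound (*-monoʳ-≤ (6 * p) (maximal S sidon))
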